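{- Let $G_\sigma$ be a balanced signed graph on $n$ vertices and let $A_\sigma\in\{0,\pm1\}^{n\times n}$ be its signed adjacency matrix. Then \[ \rho_{\mathrm{per}}(A_\sigma)+\eta_{\mathrm{per}}(A_\sigma)=n . \]
   Context: A signed graph $G_\sigma$ is a simple undirected graph with each edge $\{u,v\}$ given a sign $\sigma(u,v)\in\{+1,-1\}$; its signed adjacency matrix has $(u,v)$ entry $\sigma(u,v)$ if $\{u,v\}$ is an edge and $0$ otherwise (so it is symmetric with zero diagonal). A cycle is positive if it contains an even number of negative edges; $G_\sigma$ is balanced if every cycle is positive. For an $m\times m$ matrix $B$, $\mathrm{per}(B)=\sum_{\sigma\in S_m}\prod_i b_{i,\sigma(i)}$. The permanental rank $\rho_{\mathrm{per}}(A)$ is the largest $k$ such that some $k\times k$ submatrix $A[I,J]$ (rows $I$, columns $J$, $|I|=|J|=k$) has nonzero permanent; the permanental nullity $\eta_{\mathrm{per}}(A)$ is the multiplicity of $0$ as a root of $\pi(A,x)=\mathrm{per}(A-xI)$. -}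

module Defs where

open import Data.Nat as ℕ using (ℕ; zero; suc; _<_; _≤_; _<?_)
open import Data.Integer as ℤ using (ℤ; +_; -_; _◃_)
open import Data.Sign as Sign using (Sign)
open import Data.Bool using (Bool; true; false; if_then_else_; _∨_; not; _∧_)
open import Data.Fin using (Fin; zero; suc; toℕ; fromℕ<)
open import Data.Fin.Properties using (_≟_)
open import Data.List using (List; []; _∷_; [_]; map; concatMap; filterᵇ; foldr; allFin)
open import Data.Bool.ListAction using (and)
open import Data.Product using (Σ; _×_; ∃-syntax)
open import Relation.Nullary using (¬_; ⌊_⌋; yes; no)
open import Relation.Binary.PropositionalEquality using (_≡_; _≢_)
open import Function.Definitions using (Injective)

record SignedGraph (n : ℕ) : Set where
  field
    edge      : Fin n → Fin n → Bool
    edge-sym  : ∀ u v → edge u v ≡ edge v u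
    edge-irr  : ∀ u → edge u u ≡ false
    sgn       : Fin n → Fin n → Sign          -- sign σ(u,v), meaningful on edges
    sgn-sym   : ∀ u v → edge u v ≡ true → sgn u v ≡ sgn v u

open SignedGraph public

adj : ∀ {n} → SignedGraph n → Fin n → Fin n → ℤ
adj G u v = if edge G u v then sgn G u v ◃ 1 else + 0

next : ∀ {m} → Fin (suc m) → Fin (suc m)
next {m} i with suc (toℕ i) <? suc m
... | yes p = fromℕ< p
... | no _  = zero

signProd : ∀ {k} → (Fin k → Sign) → Sign
signProd {zero}  f = Sign.+
signProd {suc k} f = f zero Sign.* signProd (λ i → f (suc i))

-- a cycle of length k = m + 3: distinct vertices c 0, …, c (k-1) with
-- c i adjacent to c (i+1 mod k)
record Cycle {n} (G : SignedGraph n) (m : ℕ) : Set where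
  field
    vtx      : Fin (suc (suc (suc m))) → Fin n
    vtx-inj  : Injective _≡_ _≡_ vtx
    vtx-adj  : ∀ i → edge G (vtx i) (vtx (next i)) ≡ true

cycleSign : ∀ {n} {G : SignedGraph n} {m} → Cycle G m → Sign
cycleSign {G = G} c = signProd (λ i → sgn G (Cycle.vtx c i) (Cycle.vtx c (next i)))

Balanced : ∀ {n} → SignedGraph n → Set
Balanced G = ∀ m (c : Cycle G m) → cycleSign c ≡ Sign.+

allFuns : ∀ m k → List (Fin m → Fin k)
allFuns zero    k = [ (λ ()) ]
allFuns (suc m) k = concatMap (λ j → map (cons j) (allFuns m k)) (allFin k)
  where
  cons : Fin k → (Fin m → Fin k) → Fin (suc m) → Fin k
  cons j f zero    = j
  cons j f (suc i) = f i

isInjᵇ : ∀ {m} → (Fin m → Fin m) → Bool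
isInjᵇ {m} f = and (concatMap (λ i → map (λ j → ⌊ i ≟ j ⌋ ∨ not ⌊ f i ≟ f j ⌋) (allFin m)) (allFin m))

perms : ∀ m → List (Fin m → Fin m)
perms m = filterᵇ isInjᵇ (allFuns m m)

module Perm {A : Set} (0# : A) (_+_ : A → A → A) (1# : A) (_*_ : A → A → A) where
  prodF : ∀ {m} → (Fin m → A) → A
  prodF {zero}  f = 1#
  prodF {suc m} f = f zero * prodF (λ i → f (suc i))

  per : ∀ {m} → (Fin m → Fin m → A) → A
  per {m} B = foldr (λ s acc → prodF (λ i → B i (s i)) + acc) 0# (perms m)

perℤ : ∀ {m} → (Fin m → Fin m → ℤ) → ℤ
perℤ = Perm.per (+ 0) ℤ._+_ (+ 1) ℤ._*_

-- Polynomials over ℤ as coefficient lists (constant term first)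

Poly : Set
Poly = List ℤ

addP : Poly → Poly → Poly
addP []       q        = q
addP p        []       = p
addP (a ∷ p)  (b ∷ q)  = (a ℤ.+ b) ∷ addP p q

mulP : Poly → Poly → Poly
mulP []      q = []
mulP (a ∷ p) q = addP (map (a ℤ.*_) q) (+ 0 ∷ mulP p q)

coeff : Poly → ℕ → ℤ
coeff []      _       = + 0
coeff (a ∷ p) zero    = a
coeff (a ∷ p) (suc k) = coeff p k

perP : ∀ {m} → (Fin m → Fin m → Poly) → Poly
perP = Perm.per [] addP [ + 1 ] mulP

perPoly : ∀ {n} → (Fin n → Fin n → ℤ) → Poly
perPoly A = perP (λ i j → if ⌊ i ≟ j ⌋ then (A i j ∷ - (+ 1) ∷ []) else [ A i j ])

-- some k×k submatrix A[I,J] (I, J k-element index sets, listed by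
-- injections Fin k → Fin n) has nonzero permanent
HasNonzeroPerMinor : ∀ {n} → (Fin n → Fin n → ℤ) → ℕ → Set
HasNonzeroPerMinor {n} A k =
  ∃[ I ] ∃[ J ] (Injective _≡_ _≡_ I × Injective _≡_ _≡_ J ×
    perℤ {k} (λ a b → A (I a) (J b)) ≢ + 0)

IsPerRank : ∀ {n} → (Fin n → Fin n → ℤ) → ℕ → Set
IsPerRank A r = HasNonzeroPerMinor A r × (∀ k → HasNonzeroPerMinor A k → k ≤ r)

-- multiplicity of 0 as a root of π(A,x): x^e divides π, x^(e+1) does not
IsPerNullity : ∀ {n} → (Fin n → Fin n → ℤ) → ℕ → Set
IsPerNullity A e = (∀ k → k < e → coeff (perPoly A) k ≡ + 0) × coeff (perPoly A) e ≢ + 0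

-- Since A has zero diagonal, the coefficient of x^k in per (A − x I) is (−1)^k times the sum,
-- over the permutations s with exactly k fixed points, of the products of the entries A i (s i)
-- at the moved points i.  Such a product vanishes unless s moves every point along an edge of G,
-- and then it is the product of the signs of the cycles of s: a 2-cycle contributes σ(u,v)², a
-- longer cycle is a cycle of G and is positive by balance.  So no cancellation occurs and
-- η_per is the least number of fixed points of such an "edge permutation".
--
-- The same computation in the subgraph induced by the moved points shows that an edge
-- permutation moving r points yields a principal r × r minor with positive permanent.
-- Conversely, a k × k minor with non-zero permanent yields k arcs x → y along edges with
-- distinct tails and distinct heads; closing the ends of the paths they form into 2-cycles
-- turns them into an edge permutation moving at least k points.

module Submission where

open import Defs
open import Data.Nat using (ℕ; _+_)
open import Data.Product using (_×_; ∃-syntax)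
open import Relation.Binary.PropositionalEquality using (_≡_)

open import Algebra.Bundles using (CommutativeMonoid)
import Algebra.Properties.CommutativeMonoid.Sum as MonoidSum
import Algebra.Properties.CommutativeSemigroup as CommutativeSemigroupProperties
open import Data.Bool using (Bool; true; false; T; _∨_; not; if_then_else_)
open import Data.Bool.ListAction using (and)
open import Data.Empty using (⊥-elim)
open import Data.Fin using (Fin; zero; suc; _≟_; toℕ; fromℕ; fromℕ<; inject₁)
open import Data.Fin.Patterns using (0F; 1F)
open import Data.Fin.Properties
  using ( suc-injective; 0≢1+n; toℕ-injective; toℕ<n; toℕ-fromℕ; toℕ-fromℕ<; toℕ-inject; toℕ-inject₁
        ; any?; pigeonhole; injective⇒≤; ¬∀⟶∃¬-smallest )
open import Data.Integer as ℤ using (ℤ; 0ℤ; 1ℤ; -1ℤ; _◃_)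
import Data.Integer.Properties as ℤ
open import Data.List using (List; []; _∷_; [_]; foldr; map)
open import Data.List.Relation.Unary.All as All using (All; []; _∷_)
import Data.List.Relation.Unary.All.Properties as All
open import Data.List.Relation.Unary.Any as Any using (Any; here; there)
import Data.List.Relation.Unary.Any.Properties as Any
open import Data.Nat as ℕ using (zero; suc; _∸_; _≤_; _<_; z≤n; s≤s)
open import Data.Nat.GeneralisedArithmetic using (fold)
open import Data.Nat.Induction using (<-wellFounded)
import Data.Nat.Properties as ℕ
open import Data.Product using (Σ; ∃; _,_; proj₁; proj₂; map₂)
open import Data.Sign as Sign using (Sign)
import Data.Sign.Properties as Sign
open import Data.Sum using (_⊎_; inj₁; inj₂)
open import Data.Unit using (tt)
open import Data.Vec.Functional using (Vector; updateAt; tail)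
open import Data.Vec.Functional.Properties using (updateAt-updates; updateAt-minimal)
open import Function using (_∘_; const)
open import Function.Definitions using (Injective)
open import Induction.WellFounded using (Acc; acc)
open import Level using (0ℓ)
open import Relation.Binary using (tri<; tri≈; tri>)
open import Relation.Binary.PropositionalEquality
  using (_≢_; refl; sym; trans; cong; cong₂; subst; subst₂; module ≡-Reasoning)
open import Relation.Nullary using (¬_; yes; no; ¬?; _×-dec_; ⌊_⌋; does; T?; decidable-stable)
open import Relation.Unary using (Pred; Decidable)

module _ {c ℓ} (M : CommutativeMonoid c ℓ) where
  open CommutativeMonoid M
    using (Carrier; _≈_; _∙_; ε; ∙-congˡ; identityˡ; setoid; commutativeSemigroup)
    renaming (sym to ≈-sym; trans to ≈-trans; reflexive to ≈-reflexive)
  open MonoidSum M using (sum; sum-cong-≋; sum-cong-≗; sum-replicate-zero)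
  open CommutativeSemigroupProperties commutativeSemigroup using (x∙yz≈y∙xz)
  open import Relation.Binary.Reasoning.Setoid setoid

  sum-extract : ∀ {n} (f : Vector Carrier n) i → sum f ≈ f i ∙ sum (updateAt f i (const ε))
  sum-extract {suc n} f zero    = ∙-congˡ (≈-sym (identityˡ _))
  sum-extract {suc n} f (suc i) = begin
    f zero ∙ sum (tail f)                                       ≈⟨ ∙-congˡ (sum-extract (tail f) i) ⟩
    f zero ∙ (f (suc i) ∙ sum (updateAt (tail f) i (const ε)))  ≈⟨ x∙yz≈y∙xz _ _ _ ⟩
    f (suc i) ∙ (f zero ∙ sum (updateAt (tail f) i (const ε)))  ∎

  sum-ε : ∀ {n} {f : Vector Carrier n} → (∀ i → f i ≈ ε) → sum f ≈ ε
  sum-ε {n} f≈ε = ≈-trans (sum-cong-≋ f≈ε) (sum-replicate-zero n)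

  sum-image : ∀ {k n} (I : Fin k → Fin n) → Injective _≡_ _≡_ I → (f : Vector Carrier n) →
              (∀ x → (∀ a → I a ≢ x) → f x ≈ ε) → sum f ≈ sum (f ∘ I)
  sum-image {zero}  I _           f outside = sum-ε (λ x → outside x λ ())
  sum-image {suc k} {n} I I-injective f outside = begin
    sum f                            ≈⟨ sum-extract f (I zero) ⟩
    f (I zero) ∙ sum f₀              ≈⟨ ∙-congˡ (sum-image (I ∘ suc) (suc-injective ∘ I-injective) f₀ outside₀) ⟩
    f (I zero) ∙ sum (f₀ ∘ I ∘ suc)  ≡⟨ cong (f (I zero) ∙_) (sum-cong-≗ λ a →
                                          updateAt-minimal _ _ f (λ eq → 0≢1+n {i = a} (I-injective (sym eq)))) ⟩
    f (I zero) ∙ sum (f ∘ I ∘ suc)   ∎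
    where
    f₀ : Vector Carrier n
    f₀ = updateAt f (I zero) (const ε)
    outside₀ : ∀ x → (∀ a → I (suc a) ≢ x) → f₀ x ≈ ε
    outside₀ x x∉I[suc] with x ≟ I zero
    ... | yes refl = ≈-reflexive (updateAt-updates (I zero) f)
    ... | no  x≢I0 = ≈-trans (≈-reflexive (updateAt-minimal _ _ f x≢I0))
                             (outside x λ { zero Ia≡x → x≢I0 (sym Ia≡x) ; (suc a) Ia≡x → x∉I[suc] a Ia≡x })

open MonoidSum Sign.*-commutativeMonoid using ()
  renaming (sum to ∏ˢ; sum-cong-≗ to ∏ˢ-cong; ∑-distrib-+ to ∏ˢ-distrib)

signProd≡∏ˢ : ∀ {m} (f : Fin m → Sign) → signProd f ≡ ∏ˢ f
signProd≡∏ˢ {zero}  f = refl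
signProd≡∏ˢ {suc m} f = cong (f zero Sign.*_) (signProd≡∏ˢ (f ∘ suc))

count : ∀ {m p} {P : Pred (Fin m) p} → Decidable P → ℕ
count {zero}  P? = 0
count {suc m} P? with P? zero
... | yes _ = suc (count (P? ∘ suc))
... | no  _ = count (P? ∘ suc)

enumerate : ∀ {m p} {P : Pred (Fin m) p} (P? : Decidable P) → Fin (count P?) → Fin m
enumerate {suc m} P? i with P? zero
enumerate {suc m} P? zero    | yes _ = zero
enumerate {suc m} P? (suc i) | yes _ = suc (enumerate (P? ∘ suc) i)
enumerate {suc m} P? i       | no  _ = suc (enumerate (P? ∘ suc) i)

enumerate-∈ : ∀ {m p} {P : Pred (Fin m) p} (P? : Decidable P) i → P (enumerate P? i)
enumerate-∈ {suc m} P? i with P? zero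
enumerate-∈ {suc m} P? zero    | yes P0 = P0
enumerate-∈ {suc m} P? (suc i) | yes _  = enumerate-∈ (P? ∘ suc) i
enumerate-∈ {suc m} P? i       | no  _  = enumerate-∈ (P? ∘ suc) i

enumerate-injective : ∀ {m p} {P : Pred (Fin m) p} (P? : Decidable P) → Injective _≡_ _≡_ (enumerate P?)
enumerate-injective {suc m} P? {i} {j} eq with P? zero
enumerate-injective {suc m} P? {zero}  {zero}  eq | yes _ = refl
enumerate-injective {suc m} P? {suc i} {suc j} eq | yes _ =
  cong suc (enumerate-injective (P? ∘ suc) (suc-injective eq))
enumerate-injective {suc m} P? {i}     {j}     eq | no  _ =
  enumerate-injective (P? ∘ suc) (suc-injective eq)

enumerate-surjective : ∀ {m p} {P : Pred (Fin m) p} (P? : Decidable P) {x} → P x →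
                       ∃[ i ] enumerate P? i ≡ x
enumerate-surjective {suc m} P? {x} Px with P? zero
enumerate-surjective {suc m} P? {zero}  Px | yes _  = zero , refl
enumerate-surjective {suc m} P? {suc x} Px | yes _  =
  let i , i↦x = enumerate-surjective (P? ∘ suc) Px in suc i , cong suc i↦x
enumerate-surjective {suc m} P? {zero}  Px | no ¬P0 = ⊥-elim (¬P0 Px)
enumerate-surjective {suc m} P? {suc x} Px | no  _  = map₂ (cong suc) (enumerate-surjective (P? ∘ suc) Px)

injectiveOn⇒count≤ : ∀ {m n p q} {P : Pred (Fin m) p} {Q : Pred (Fin n) q}
  (P? : Decidable P) (Q? : Decidable Q) (h : Fin m → Fin n) →
  (∀ {x y} → P x → P y → h x ≡ h y → x ≡ y) → (∀ {x} → P x → Q (h x)) →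
  count P? ≤ count Q?
injectiveOn⇒count≤ P? Q? h h-injective h-into = injective⇒≤ index-injective
  where
  index : ∀ i → ∃[ j ] enumerate Q? j ≡ h (enumerate P? i)
  index i = enumerate-surjective Q? (h-into (enumerate-∈ P? i))
  index-injective : Injective _≡_ _≡_ (proj₁ ∘ index)
  index-injective {i} {j} eq = enumerate-injective P?
    (h-injective (enumerate-∈ P? i) (enumerate-∈ P? j)
      (trans (sym (proj₂ (index i))) (trans (cong (enumerate Q?) eq) (proj₂ (index j)))))

count-mono : ∀ {m p q} {P : Pred (Fin m) p} {Q : Pred (Fin m) q} (P? : Decidable P) (Q? : Decidable Q) →
             (∀ {x} → P x → Q x) → count P? ≤ count Q?
count-mono P? Q? P⊆Q = injectiveOn⇒count≤ P? Q? (λ x → x) (λ _ _ eq → eq) P⊆Q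

count-< : ∀ {m p q} {P : Pred (Fin m) p} {Q : Pred (Fin m) q} (P? : Decidable P) (Q? : Decidable Q) →
          (∀ {x} → P x → Q x) → ∀ {v} → Q v → ¬ P v → count P? < count Q?
count-< {suc m} P? Q? P⊆Q {v} Qv ¬Pv with P? zero | Q? zero | v
... | yes P0 | _      | zero  = ⊥-elim (¬Pv P0)
... | _      | no ¬Q0 | zero  = ⊥-elim (¬Q0 Qv)
... | no  _  | yes _  | zero  = s≤s (count-mono (P? ∘ suc) (Q? ∘ suc) P⊆Q)
... | yes P0 | no ¬Q0 | suc _ = ⊥-elim (¬Q0 (P⊆Q P0))
... | yes _  | yes _  | suc v = s≤s (count-< (P? ∘ suc) (Q? ∘ suc) P⊆Q Qv ¬Pv)
... | no  _  | yes _  | suc v = ℕ.m≤n⇒m≤1+n (count-< (P? ∘ suc) (Q? ∘ suc) P⊆Q Qv ¬Pv)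
... | no  _  | no  _  | suc v = count-< (P? ∘ suc) (Q? ∘ suc) P⊆Q Qv ¬Pv

count-all : ∀ {m p} {P : Pred (Fin m) p} (P? : Decidable P) → (∀ x → P x) → count P? ≡ m
count-all {zero}  P? all = refl
count-all {suc m} P? all with P? zero
... | yes _  = cong suc (count-all (P? ∘ suc) (all ∘ suc))
... | no ¬P0 = ⊥-elim (¬P0 (all zero))

count-+-count-¬ : ∀ {m p} {P : Pred (Fin m) p} (P? : Decidable P) → count P? + count (¬? ∘ P?) ≡ m
count-+-count-¬ {zero}  P? = refl
count-+-count-¬ {suc m} P? with P? zero
... | yes _ = cong suc (count-+-count-¬ (P? ∘ suc))
... | no  _ = trans (ℕ.+-suc _ _) (cong suc (count-+-count-¬ (P? ∘ suc)))

least : ∀ {p} {P : Pred ℕ p} → Decidable P → ∀ {n} → P n → ∃[ k ] P k × (∀ {j} → j < k → ¬ P j)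
least {P = P} P? {n} Pn
  with ¬∀⟶∃¬-smallest (suc n) (¬_ ∘ P ∘ toℕ) (¬? ∘ P? ∘ toℕ)
                       (λ ¬P → ¬P (fromℕ n) (subst P (sym (toℕ-fromℕ n)) Pn))
... | i , ¬¬Pi , before = toℕ i , decidable-stable (P? (toℕ i)) ¬¬Pi , λ j<i →
  subst (¬_ ∘ P) (trans (toℕ-inject _) (toℕ-fromℕ< j<i)) (before (fromℕ< j<i))

prodℤ : ∀ {m} → (Fin m → ℤ) → ℤ
prodℤ = Perm.prodF 0ℤ ℤ._+_ 1ℤ ℤ._*_

prodℤ-cong : ∀ {m} {f g : Fin m → ℤ} → (∀ i → f i ≡ g i) → prodℤ f ≡ prodℤ g
prodℤ-cong {zero}  f≗g = refl
prodℤ-cong {suc m} f≗g = cong₂ ℤ._*_ (f≗g zero) (prodℤ-cong (f≗g ∘ suc))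

prodℤ-zero : ∀ {m} (f : Fin m → ℤ) {i} → f i ≡ 0ℤ → prodℤ f ≡ 0ℤ
prodℤ-zero f {zero}  fi≡0 = cong (ℤ._* prodℤ (f ∘ suc)) fi≡0
prodℤ-zero f {suc i} fi≡0 = trans (cong (f zero ℤ.*_) (prodℤ-zero (f ∘ suc) fi≡0)) (ℤ.*-zeroʳ (f zero))

prodℤ-◃ : ∀ {m} (s : Fin m → Sign) → prodℤ (λ i → s i ◃ 1) ≡ ∏ˢ s ◃ 1
prodℤ-◃ {zero}  s = refl
prodℤ-◃ {suc m} s = trans (cong ((s zero ◃ 1) ℤ.*_) (prodℤ-◃ (s ∘ suc))) (sym (ℤ.◃-distrib-* (s zero) _ 1 1))

sumℤ : ∀ {A : Set} → (A → ℤ) → List A → ℤ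
sumℤ h = foldr (λ x acc → h x ℤ.+ acc) 0ℤ

sumℤ-cong : ∀ {A : Set} {h g : A → ℤ} → (∀ x → h x ≡ g x) → ∀ xs → sumℤ h xs ≡ sumℤ g xs
sumℤ-cong h≗g []       = refl
sumℤ-cong h≗g (x ∷ xs) = cong₂ ℤ._+_ (h≗g x) (sumℤ-cong h≗g xs)

sumℤ-*ˡ : ∀ {A : Set} c (h : A → ℤ) xs → sumℤ (λ x → c ℤ.* h x) xs ≡ c ℤ.* sumℤ h xs
sumℤ-*ˡ c h []       = sym (ℤ.*-zeroʳ c)
sumℤ-*ˡ c h (x ∷ xs) = trans (cong (ℤ._+_ (c ℤ.* h x)) (sumℤ-*ˡ c h xs)) (sym (ℤ.*-distribˡ-+ c (h x) _))

sumℤ≢0⇒ : ∀ {A : Set} (h : A → ℤ) xs → sumℤ h xs ≢ 0ℤ → Any (λ x → h x ≢ 0ℤ) xs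
sumℤ≢0⇒ h []       sum≢0 = ⊥-elim (sum≢0 refl)
sumℤ≢0⇒ h (x ∷ xs) sum≢0 with h x ℤ.≟ 0ℤ
... | no  hx≢0 = here hx≢0
... | yes hx≡0 = there (sumℤ≢0⇒ h xs λ rest≡0 → sum≢0 (cong₂ ℤ._+_ hx≡0 rest≡0))

sumℤ-nonneg : ∀ {A : Set} (h : A → ℤ) {xs} → All (λ x → 0ℤ ℤ.≤ h x) xs → 0ℤ ℤ.≤ sumℤ h xs
sumℤ-nonneg h []           = ℤ.≤-refl
sumℤ-nonneg h (hx≥0 ∷ ≥0s) = ℤ.+-mono-≤ hx≥0 (sumℤ-nonneg h ≥0s)

sumℤ-pos : ∀ {A : Set} (h : A → ℤ) {xs} → All (λ x → 0ℤ ℤ.≤ h x) xs → Any (λ x → 0ℤ ℤ.< h x) xs →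
           0ℤ ℤ.< sumℤ h xs
sumℤ-pos h (_    ∷ ≥0s) (here hx>0) = ℤ.+-mono-<-≤ hx>0 (sumℤ-nonneg h ≥0s)
sumℤ-pos h (hx≥0 ∷ ≥0s) (there >0)  = ℤ.+-mono-≤-< hx≥0 (sumℤ-pos h ≥0s >0)

∈01⇒nonneg : ∀ {c} → c ≡ 0ℤ ⊎ c ≡ 1ℤ → 0ℤ ℤ.≤ c
∈01⇒nonneg (inj₁ refl) = ℤ.≤-refl
∈01⇒nonneg (inj₂ refl) = ℤ.+≤+ z≤n

if-≢0 : ∀ b {c} → (if b then c else 0ℤ) ≢ 0ℤ → T b × c ≢ 0ℤ
if-≢0 true  c≢0 = _ , c≢0
if-≢0 false 0≢0 = ⊥-elim (0≢0 refl)

T-and⁻ : ∀ bs → T (and bs) → All T bs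
T-and⁻ []          _ = []
T-and⁻ (true ∷ bs) t = _ ∷ T-and⁻ bs t

T-and⁺ : ∀ {bs} → All T bs → T (and bs)
T-and⁺ []                  = _
T-and⁺ {true ∷ _} (_ ∷ ts) = T-and⁺ ts

module _ {m} (f : Fin m → Fin m) where

  injectiveAtᵇ : Fin m → Fin m → Bool
  injectiveAtᵇ i j = ⌊ i ≟ j ⌋ ∨ not ⌊ f i ≟ f j ⌋

  T-injectiveAtᵇ⁻ : ∀ {i j} → T (injectiveAtᵇ i j) → f i ≡ f j → i ≡ j
  T-injectiveAtᵇ⁻ {i} {j} t fi≡fj with i ≟ j | f i ≟ f j
  ... | yes i≡j | _        = i≡j
  ... | no  _   | yes _    = ⊥-elim t
  ... | no  _   | no fi≢fj = ⊥-elim (fi≢fj fi≡fj)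

  T-injectiveAtᵇ⁺ : ∀ {i j} → (f i ≡ f j → i ≡ j) → T (injectiveAtᵇ i j)
  T-injectiveAtᵇ⁺ {i} {j} injective-at with i ≟ j | f i ≟ f j
  ... | yes _   | _         = _
  ... | no  i≢j | yes fi≡fj = i≢j (injective-at fi≡fj)
  ... | no  _   | no  _     = _

  isInjᵇ-sound : T (isInjᵇ f) → Injective _≡_ _≡_ f
  isInjᵇ-sound t {i} {j} = T-injectiveAtᵇ⁻
    (All.tabulate⁻ (All.map⁻ (All.tabulate⁻ (All.map⁻ (All.concat⁻ (T-and⁻ _ t))) i)) j)

  isInjᵇ-complete : Injective _≡_ _≡_ f → T (isInjᵇ f)
  isInjᵇ-complete f-injective = T-and⁺ (All.concat⁺ (All.map⁺ (All.tabulate⁺ λ i →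
    All.map⁺ (All.tabulate⁺ λ j → T-injectiveAtᵇ⁺ {i} {j} f-injective))))

allFuns-complete : ∀ m {k} (f : Fin m → Fin k) → Any (λ g → ∀ i → g i ≡ f i) (allFuns m k)
allFuns-complete zero    f = here λ ()
allFuns-complete (suc m) f =
  Any.concat⁺ (Any.map⁺ (Any.tabulate⁺ (f zero)
    (Any.map⁺ (Any.map (λ g≗f → λ { zero → refl ; (suc i) → g≗f i }) (allFuns-complete m (f ∘ suc))))))

perms-injective : ∀ m → All (Injective _≡_ _≡_) (perms m)
perms-injective m = All.map (λ {s} → isInjᵇ-sound s) (All.all-filter (T? ∘ isInjᵇ) (allFuns m m))

perms-complete : ∀ {m} {f : Fin m → Fin m} → Injective _≡_ _≡_ f → Any (λ g → ∀ i → g i ≡ f i) (perms m)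
perms-complete {m} {f} f-injective with Any.filter⁺ (T? ∘ isInjᵇ) (allFuns-complete m f)
... | inj₁ found      = found
... | inj₂ ¬injective = ⊥-elim (¬injective (isInjᵇ-complete _ λ {i} {j} gi≡gj → f-injective
                          (trans (sym (g≗f i)) (trans gi≡gj (g≗f j)))))
  where
  g≗f : ∀ i → Any.lookup (allFuns-complete m f) i ≡ f i
  g≗f = Any.lookup-result (allFuns-complete m f)

sum-perms≢0⇒ : ∀ {m} (h : (Fin m → Fin m) → ℤ) → sumℤ h (perms m) ≢ 0ℤ →
               ∃[ t ] Injective _≡_ _≡_ t × h t ≢ 0ℤ
sum-perms≢0⇒ {m} h sum≢0 = Any.lookup nonzero , All.lookupAny (perms-injective m) nonzero
  where
  nonzero : Any (λ t → h t ≢ 0ℤ) (perms m)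
  nonzero = sumℤ≢0⇒ h (perms m) sum≢0

sum-perms-pos : ∀ {m} (h : (Fin m → Fin m) → ℤ) → (∀ {t} → Injective _≡_ _≡_ t → 0ℤ ℤ.≤ h t) →
                ∀ {t} → Injective _≡_ _≡_ t → (∀ {g} → (∀ i → g i ≡ t i) → 0ℤ ℤ.< h g) →
                0ℤ ℤ.< sumℤ h (perms m)
sum-perms-pos {m} h nonneg t-injective positive =
  sumℤ-pos h (All.map nonneg (perms-injective m)) (Any.map positive (perms-complete t-injective))

-- The coefficients of per (A − x I)

-X : Poly
-X = 0ℤ ∷ -1ℤ ∷ []

prodP : ∀ {m} → (Fin m → Poly) → Poly
prodP = Perm.prodF [] addP [ 1ℤ ] mulP

prodP-cong : ∀ {m} {f g : Fin m → Poly} → (∀ i → f i ≡ g i) → prodP f ≡ prodP g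
prodP-cong {zero}  f≗g = refl
prodP-cong {suc m} f≗g = cong₂ mulP (f≗g zero) (prodP-cong (f≗g ∘ suc))

coeff-addP : ∀ p q k → coeff (addP p q) k ≡ coeff p k ℤ.+ coeff q k
coeff-addP []      q       k       = sym (ℤ.+-identityˡ _)
coeff-addP (a ∷ p) []      k       = sym (ℤ.+-identityʳ _)
coeff-addP (a ∷ p) (b ∷ q) zero    = refl
coeff-addP (a ∷ p) (b ∷ q) (suc k) = coeff-addP p q k

coeff-sumP : ∀ {A : Set} (f : A → Poly) xs k →
             coeff (foldr (λ x acc → addP (f x) acc) [] xs) k ≡ sumℤ (λ x → coeff (f x) k) xs
coeff-sumP f []       k = refl
coeff-sumP f (x ∷ xs) k = trans (coeff-addP (f x) _ k) (cong (ℤ._+_ (coeff (f x) k)) (coeff-sumP f xs k))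

coeff-scale : ∀ a q k → coeff (map (a ℤ.*_) q) k ≡ a ℤ.* coeff q k
coeff-scale a []      k       = sym (ℤ.*-zeroʳ a)
coeff-scale a (b ∷ q) zero    = refl
coeff-scale a (b ∷ q) (suc k) = coeff-scale a q k

coeff-[0] : ∀ k → coeff [ 0ℤ ] k ≡ 0ℤ
coeff-[0] zero    = refl
coeff-[0] (suc k) = refl

coeff-[_]* : ∀ a q k → coeff (mulP [ a ] q) k ≡ a ℤ.* coeff q k
coeff-[ a ]* q k = begin
  coeff (addP (map (a ℤ.*_) q) [ 0ℤ ]) k       ≡⟨ coeff-addP (map (a ℤ.*_) q) [ 0ℤ ] k ⟩
  coeff (map (a ℤ.*_) q) k ℤ.+ coeff [ 0ℤ ] k  ≡⟨ cong₂ ℤ._+_ (coeff-scale a q k) (coeff-[0] k) ⟩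
  a ℤ.* coeff q k ℤ.+ 0ℤ                       ≡⟨ ℤ.+-identityʳ _ ⟩
  a ℤ.* coeff q k                              ∎
  where open ≡-Reasoning

coeff--X*-zero : ∀ q → coeff (mulP -X q) zero ≡ 0ℤ
coeff--X*-zero q = trans (coeff-addP (map (0ℤ ℤ.*_) q) _ zero) (cong (ℤ._+ 0ℤ) (coeff-scale 0ℤ q zero))

coeff--X*-suc : ∀ q k → coeff (mulP -X q) (suc k) ≡ -1ℤ ℤ.* coeff q k
coeff--X*-suc q k = begin
  coeff (addP (map (0ℤ ℤ.*_) q) (0ℤ ∷ mulP [ -1ℤ ] q)) (suc k)  ≡⟨ coeff-addP (map (0ℤ ℤ.*_) q) _ (suc k) ⟩
  coeff (map (0ℤ ℤ.*_) q) (suc k) ℤ.+ coeff (mulP [ -1ℤ ] q) k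
    ≡⟨ cong₂ ℤ._+_ (coeff-scale 0ℤ q (suc k)) (coeff-[ -1ℤ ]* q k) ⟩
  0ℤ ℤ.+ -1ℤ ℤ.* coeff q k                                      ≡⟨ ℤ.+-identityˡ _ ⟩
  -1ℤ ℤ.* coeff q k                                             ∎
  where open ≡-Reasoning

-- Coefficientwise, since the coefficient lists of Poly may carry trailing zeros.
IsMonomial : Poly → ℤ → ℕ → Set
IsMonomial p c d = ∀ k → coeff p k ≡ (if d ℕ.≡ᵇ k then c else 0ℤ)

*-if : ∀ a b c → a ℤ.* (if b then c else 0ℤ) ≡ (if b then a ℤ.* c else 0ℤ)
*-if a true  c = refl
*-if a false c = ℤ.*-zeroʳ a

[_]*-monomial : ∀ a q {c d} → IsMonomial q c d → IsMonomial (mulP [ a ] q) (a ℤ.* c) d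
[ a ]*-monomial q {c} {d} q≈cXᵈ k =
  trans (coeff-[ a ]* q k) (trans (cong (a ℤ.*_) (q≈cXᵈ k)) (*-if a (d ℕ.≡ᵇ k) c))

-X*-monomial : ∀ q {c d} → IsMonomial q c d → IsMonomial (mulP -X q) (-1ℤ ℤ.* c) (suc d)
-X*-monomial q         q≈cXᵈ zero    = coeff--X*-zero q
-X*-monomial q {c} {d} q≈cXᵈ (suc k) =
  trans (coeff--X*-suc q k) (trans (cong (-1ℤ ℤ.*_) (q≈cXᵈ k)) (*-if -1ℤ (d ℕ.≡ᵇ k) c))

prodP-monomial : ∀ {m p} {P : Pred (Fin m) p} (P? : Decidable P) (c : Fin m → ℤ) →
  IsMonomial (prodP (λ i → if does (P? i) then -X else [ c i ]))
             (prodℤ (λ i → if does (P? i) then -1ℤ else c i)) (count P?)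
prodP-monomial {zero}  P? c zero    = refl
prodP-monomial {zero}  P? c (suc k) = refl
prodP-monomial {suc m} P? c with P? zero
... | yes _ = -X*-monomial rest (prodP-monomial (P? ∘ suc) (c ∘ suc))
  where
  rest : Poly
  rest = prodP (λ i → if does (P? (suc i)) then -X else [ c (suc i) ])
... | no  _ = [ c zero ]*-monomial rest {d = count (P? ∘ suc)} (prodP-monomial (P? ∘ suc) (c ∘ suc))
  where
  rest : Poly
  rest = prodP (λ i → if does (P? (suc i)) then -X else [ c (suc i) ])

prodℤ-−1 : ∀ {m p} {P : Pred (Fin m) p} (P? : Decidable P) (c : Fin m → ℤ) →
  prodℤ (λ i → if does (P? i) then -1ℤ else c i) ≡
  -1ℤ ℤ.^ count P? ℤ.* prodℤ (λ i → if does (P? i) then 1ℤ else c i)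
prodℤ-−1 {zero}  P? c = refl
prodℤ-−1 {suc m} P? c with P? zero
... | yes _ = begin
  -1ℤ ℤ.* prodℤ (λ i → if does (P? (suc i)) then -1ℤ else c (suc i))
    ≡⟨ cong (-1ℤ ℤ.*_) (prodℤ-−1 (P? ∘ suc) (c ∘ suc)) ⟩
  -1ℤ ℤ.* (-1ℤ ℤ.^ d ℤ.* rest)     ≡⟨ sym (ℤ.*-assoc -1ℤ (-1ℤ ℤ.^ d) rest) ⟩
  -1ℤ ℤ.^ suc d ℤ.* rest           ≡⟨ cong (-1ℤ ℤ.^ suc d ℤ.*_) (sym (ℤ.*-identityˡ rest)) ⟩
  -1ℤ ℤ.^ suc d ℤ.* (1ℤ ℤ.* rest)  ∎
  where
  open ≡-Reasoning
  d : ℕ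
  d = count (P? ∘ suc)
  rest : ℤ
  rest = prodℤ (λ i → if does (P? (suc i)) then 1ℤ else c (suc i))
... | no  _ = trans (cong (c zero ℤ.*_) (prodℤ-−1 (P? ∘ suc) (c ∘ suc)))
                    (x∙yz≈y∙xz (c zero) (-1ℤ ℤ.^ count (P? ∘ suc)) _)
  where open CommutativeSemigroupProperties ℤ.*-commutativeSemigroup using (x∙yz≈y∙xz)

fixedPoints : ∀ {n} → (Fin n → Fin n) → ℕ
fixedPoints s = count (λ i → i ≟ s i)

moved? : ∀ {n} (s : Fin n → Fin n) → Decidable (λ x → x ≢ s x)
moved? s x = ¬? (x ≟ s x)

movedPoints : ∀ {n} → (Fin n → Fin n) → ℕ
movedPoints s = count (moved? s)

movedPoints≡n∸fixedPoints : ∀ {n} (s : Fin n → Fin n) → movedPoints s ≡ n ∸ fixedPoints s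
movedPoints≡n∸fixedPoints s = trans (sym (ℕ.m+n∸m≡n (fixedPoints s) (movedPoints s)))
                                    (cong (_∸ fixedPoints s) (count-+-count-¬ (λ i → i ≟ s i)))

fixedPoints-cong : ∀ {n} {s t : Fin n → Fin n} → (∀ i → s i ≡ t i) → fixedPoints s ≡ fixedPoints t
fixedPoints-cong s≗t = ℕ.≤-antisym
  (count-mono (λ i → i ≟ _) (λ i → i ≟ _) λ {i} i≡si → trans i≡si (s≗t i))
  (count-mono (λ i → i ≟ _) (λ i → i ≟ _) λ {i} i≡ti → trans i≡ti (sym (s≗t i)))

offDiagonalTerm : ∀ {n} → (Fin n → Fin n → ℤ) → (Fin n → Fin n) → ℤ
offDiagonalTerm A s = prodℤ (λ i → if does (i ≟ s i) then 1ℤ else A i (s i))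

permanentTerm-derangement : ∀ {n} (A : Fin n → Fin n → ℤ) {t} → (∀ a → a ≢ t a) →
                            prodℤ (λ a → A a (t a)) ≡ offDiagonalTerm A t
permanentTerm-derangement A {t} derangement = prodℤ-cong factor
  where
  factor : ∀ a → A a (t a) ≡ (if does (a ≟ t a) then 1ℤ else A a (t a))
  factor a with a ≟ t a
  ... | yes a-fixed = ⊥-elim (derangement a a-fixed)
  ... | no  _       = refl

coeff-perPoly : ∀ {n} (A : Fin n → Fin n → ℤ) → (∀ i → A i i ≡ 0ℤ) → ∀ k →
  coeff (perPoly A) k ≡
  -1ℤ ℤ.^ k ℤ.* sumℤ (λ s → if fixedPoints s ℕ.≡ᵇ k then offDiagonalTerm A s else 0ℤ) (perms n)
coeff-perPoly {n} A diagonal≡0 k = begin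
  coeff (perPoly A) k                                           ≡⟨ coeff-sumP (λ s → prodP (λ i → entry i (s i))) (perms n) k ⟩
  sumℤ (λ s → coeff (prodP (λ i → entry i (s i))) k) (perms n)  ≡⟨ sumℤ-cong term (perms n) ⟩
  sumℤ (λ s → -1ℤ ℤ.^ k ℤ.* fixedTerm s) (perms n)             ≡⟨ sumℤ-*ˡ (-1ℤ ℤ.^ k) fixedTerm (perms n) ⟩
  -1ℤ ℤ.^ k ℤ.* sumℤ fixedTerm (perms n)                        ∎
  where
  open ≡-Reasoning
  entry : Fin n → Fin n → Poly
  entry i j = if ⌊ i ≟ j ⌋ then (A i j ∷ -1ℤ ∷ []) else [ A i j ]
  entry-monomial : ∀ i j → entry i j ≡ (if does (i ≟ j) then -X else [ A i j ])
  entry-monomial i j with i ≟ j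
  ... | yes refl = cong (_∷ -1ℤ ∷ []) (diagonal≡0 i)
  ... | no  _    = refl
  fixedTerm : (Fin n → Fin n) → ℤ
  fixedTerm s = if fixedPoints s ℕ.≡ᵇ k then offDiagonalTerm A s else 0ℤ
  sign-at-k : ∀ d c → (if d ℕ.≡ᵇ k then -1ℤ ℤ.^ d ℤ.* c else 0ℤ) ≡
                      -1ℤ ℤ.^ k ℤ.* (if d ℕ.≡ᵇ k then c else 0ℤ)
  sign-at-k d c with d ℕ.≡ᵇ k in d≡ᵇk
  ... | true  rewrite ℕ.≡ᵇ⇒≡ d k (subst T (sym d≡ᵇk) _) = refl
  ... | false = sym (ℤ.*-zeroʳ (-1ℤ ℤ.^ k))
  term : ∀ s → coeff (prodP (λ i → entry i (s i))) k ≡ -1ℤ ℤ.^ k ℤ.* fixedTerm s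
  term s = begin
    coeff (prodP (λ i → entry i (s i))) k
      ≡⟨ cong (λ p → coeff p k) (prodP-cong (λ i → entry-monomial i (s i))) ⟩
    coeff (prodP (λ i → if does (i ≟ s i) then -X else [ A i (s i) ])) k
      ≡⟨ prodP-monomial (λ i → i ≟ s i) (λ i → A i (s i)) k ⟩
    (if fixedPoints s ℕ.≡ᵇ k then prodℤ (λ i → if does (i ≟ s i) then -1ℤ else A i (s i)) else 0ℤ)
      ≡⟨ cong (λ c → if fixedPoints s ℕ.≡ᵇ k then c else 0ℤ) (prodℤ-−1 (λ i → i ≟ s i) (λ i → A i (s i))) ⟩
    (if fixedPoints s ℕ.≡ᵇ k then -1ℤ ℤ.^ fixedPoints s ℤ.* offDiagonalTerm A s else 0ℤ)
      ≡⟨ sign-at-k (fixedPoints s) (offDiagonalTerm A s) ⟩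
    -1ℤ ℤ.^ k ℤ.* fixedTerm s                                                            ∎

-- Orbits of a permutation

next-cases : ∀ {m} (i : Fin (suc m)) → toℕ (next i) ≡ suc (toℕ i) ⊎ (next i ≡ zero × toℕ i ≡ m)
next-cases {m} i with suc (toℕ i) ℕ.<? suc m
... | yes i+1<1+m = inj₁ (toℕ-fromℕ< i+1<1+m)
... | no  i+1≮1+m = inj₂ (refl , ℕ.≤-antisym (ℕ.≤-pred (toℕ<n i)) (ℕ.≮⇒≥ (i+1≮1+m ∘ s≤s)))

next≢id : ∀ {m} (i : Fin (suc (suc m))) → next i ≢ i
next≢id i next-i≡i with next-cases i
... | inj₁ toℕ-next≡1+i = ℕ.1+n≢n (trans (sym toℕ-next≡1+i) (cong toℕ next-i≡i))
... | inj₂ (next-i≡0 , toℕ-i≡last) with trans (sym next-i≡i) next-i≡0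
... | refl with toℕ-i≡last
... | ()

next-surjective : ∀ {m} (j : Fin (suc m)) → ∃[ i ] next i ≡ j
next-surjective {m} zero with next-cases (fromℕ m)
... | inj₁ toℕ-next≡1+m = ⊥-elim (ℕ.<-irrefl (cong suc (toℕ-fromℕ m)) (subst (ℕ._< suc m) toℕ-next≡1+m (toℕ<n _)))
... | inj₂ (next-last≡0 , _) = fromℕ m , next-last≡0
next-surjective (suc j) with next-cases (inject₁ j)
... | inj₁ toℕ-next≡1+j = inject₁ j , toℕ-injective (trans toℕ-next≡1+j (cong suc (toℕ-inject₁ j)))
... | inj₂ (_ , toℕ-j≡last) = ⊥-elim (ℕ.<-irrefl (trans (sym (toℕ-inject₁ j)) toℕ-j≡last) (toℕ<n j))

record Orbit {m} (p : Fin m → Fin m) (k : ℕ) : Set where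
  field
    point           : Fin (suc k) → Fin m
    point-injective : Injective _≡_ _≡_ point
    p-point         : ∀ j → p (point j) ≡ point (next j)

module _ {m} {p : Fin m → Fin m} {k} (O : Orbit p k) where
  open Orbit O

  InOrbit : Pred (Fin m) 0ℓ
  InOrbit x = ∃[ j ] point j ≡ x

  inOrbit? : Decidable InOrbit
  inOrbit? x = any? (λ j → point j ≟ x)

  InOrbit-p⁻¹ : Injective _≡_ _≡_ p → ∀ {y} → InOrbit (p y) → InOrbit y
  InOrbit-p⁻¹ p-injective {y} (j , point-j≡py) with next-surjective j
  ... | i , next-i≡j = i , p-injective (trans (p-point i) (trans (cong point next-i≡j) point-j≡py))

module _ {m} {p : Fin m → Fin m} (p-injective : Injective _≡_ _≡_ p) (a : Fin m) where
  private
    iter : ℕ → Fin m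
    iter = fold a p

    Returns : ℕ → Set
    Returns d = iter (suc d) ≡ a

    iter-cancel : ∀ i d → iter i ≡ iter (i + d) → a ≡ iter d
    iter-cancel zero    d eq = eq
    iter-cancel (suc i) d eq = iter-cancel i d (p-injective eq)

    returns-between : ∀ {i j} → i < j → iter i ≡ iter j → ∃[ d ] suc i + d ≡ j × Returns d
    returns-between {i} {j} i<j iterᵢ≡iterⱼ with ℕ.m≤n⇒∃[o]m+o≡n {suc i} {j} i<j
    ... | d , 1+i+d≡j = d , 1+i+d≡j , sym (iter-cancel i (suc d)
      (trans iterᵢ≡iterⱼ (cong iter (trans (sym 1+i+d≡j) (sym (ℕ.+-suc i d))))))

    some-return : ∃ Returns
    some-return with pigeonhole (ℕ.n<1+n m) (iter ∘ toℕ)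
    ... | i , j , i<j , iterᵢ≡iterⱼ with returns-between i<j iterᵢ≡iterⱼ
    ... | d , _ , returns = d , returns

  orbitThrough : ∃[ k ] Σ (Orbit p k) λ O → Orbit.point O zero ≡ a
  orbitThrough with least (λ d → iter (suc d) ≟ a) {proj₁ some-return} (proj₂ some-return)
  ... | k , returns , first = k , record
    { point           = iter ∘ toℕ
    ; point-injective = point-injective
    ; p-point         = p-point
    } , refl
    where
    distinct : ∀ {i j} → i < j → j ≤ k → iter i ≢ iter j
    distinct {i} i<j j≤k iterᵢ≡iterⱼ with returns-between i<j iterᵢ≡iterⱼ
    ... | d , 1+i+d≡j , returns-d = first (ℕ.≤-trans (s≤s (ℕ.m≤n+m d i)) (subst (_≤ k) (sym 1+i+d≡j) j≤k)) returns-d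
    point-injective : Injective _≡_ _≡_ (iter ∘ toℕ)
    point-injective {i} {j} eq with ℕ.<-cmp (toℕ i) (toℕ j)
    ... | tri< i<j _ _ = ⊥-elim (distinct i<j (ℕ.≤-pred (toℕ<n j)) eq)
    ... | tri≈ _ i≡j _ = toℕ-injective i≡j
    ... | tri> _ _ j<i = ⊥-elim (distinct j<i (ℕ.≤-pred (toℕ<n i)) (sym eq))
    p-point : ∀ j → p (iter (toℕ j)) ≡ iter (toℕ (next j))
    p-point j with next-cases j
    ... | inj₁ toℕ-next≡1+j       = cong iter (sym toℕ-next≡1+j)
    ... | inj₂ (next≡0 , toℕ-j≡k) = trans (cong (p ∘ iter) toℕ-j≡k) (trans returns (cong (iter ∘ toℕ) (sym next≡0)))

module _ {m} {s : Fin m → Fin m} {k} (O : Orbit s k) where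

  withoutOrbit : Fin m → Fin m
  withoutOrbit x with inOrbit? O x
  ... | yes _ = x
  ... | no  _ = s x

  withoutOrbit-cases : ∀ x → (InOrbit O x × withoutOrbit x ≡ x) ⊎ (¬ InOrbit O x × withoutOrbit x ≡ s x)
  withoutOrbit-cases x with inOrbit? O x
  ... | yes x∈O = inj₁ (x∈O , refl)
  ... | no  x∉O = inj₂ (x∉O , refl)

  withoutOrbit-injective : Injective _≡_ _≡_ s → Injective _≡_ _≡_ withoutOrbit
  withoutOrbit-injective s-injective {x} {y} eq with withoutOrbit-cases x | withoutOrbit-cases y
  ... | inj₁ (_ , x↦x)    | inj₁ (_ , y↦y)    = trans (sym x↦x) (trans eq y↦y)
  ... | inj₂ (_ , x↦sx)   | inj₂ (_ , y↦sy)   = s-injective (trans (sym x↦sx) (trans eq y↦sy))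
  ... | inj₁ (x∈O , x↦x)  | inj₂ (y∉O , y↦sy) =
    ⊥-elim (y∉O (InOrbit-p⁻¹ O s-injective (subst (InOrbit O) (trans (sym x↦x) (trans eq y↦sy)) x∈O)))
  ... | inj₂ (x∉O , x↦sx) | inj₁ (y∈O , y↦y)  =
    ⊥-elim (x∉O (InOrbit-p⁻¹ O s-injective (subst (InOrbit O) (trans (sym y↦y) (trans (sym eq) x↦sx)) y∈O)))

  withoutOrbit-moved : ∀ {x} → x ≢ withoutOrbit x → ¬ InOrbit O x × withoutOrbit x ≡ s x
  withoutOrbit-moved {x} x-moved with withoutOrbit-cases x
  ... | inj₁ (_ , x↦x) = ⊥-elim (x-moved (sym x↦x))
  ... | inj₂ x∉O       = x∉O

  withoutOrbit-movesFewer : Orbit.point O zero ≢ s (Orbit.point O zero) → movedPoints withoutOrbit < movedPoints s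
  withoutOrbit-movesFewer start-moved = count-< (moved? withoutOrbit) (moved? s)
    (λ x-moved → subst (_ ≢_) (proj₂ (withoutOrbit-moved x-moved)) x-moved)
    start-moved
    (λ start-moved′ → proj₁ (withoutOrbit-moved start-moved′) (zero , refl))

-- In a balanced signed graph every edge permutation has sign +

restrict : ∀ {n m} → SignedGraph n → (Fin m → Fin n) → SignedGraph m
restrict G I = record
  { edge     = λ a b → edge G (I a) (I b)
  ; edge-sym = λ a b → edge-sym G (I a) (I b)
  ; edge-irr = λ a → edge-irr G (I a)
  ; sgn      = λ a b → sgn G (I a) (I b)
  ; sgn-sym  = λ a b → sgn-sym G (I a) (I b)
  }

balanced-restrict : ∀ {n m} {G : SignedGraph n} {I : Fin m → Fin n} →
                    Injective _≡_ _≡_ I → Balanced G → Balanced (restrict G I)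
balanced-restrict {I = I} I-injective balanced k C = balanced k record
  { vtx     = I ∘ Cycle.vtx C
  ; vtx-inj = Cycle.vtx-inj C ∘ I-injective
  ; vtx-adj = Cycle.vtx-adj C
  }

edge⇒≢ : ∀ {n} (G : SignedGraph n) {x y} → edge G x y ≡ true → x ≢ y
edge⇒≢ G {x} xy refl with trans (sym xy) (edge-irr G x)
... | ()

adj-diagonal : ∀ {n} (G : SignedGraph n) i → adj G i i ≡ 0ℤ
adj-diagonal G i = cong (λ b → if b then sgn G i i ◃ 1 else 0ℤ) (edge-irr G i)

adj-edge : ∀ {n} (G : SignedGraph n) {u v} → edge G u v ≡ true → adj G u v ≡ sgn G u v ◃ 1
adj-edge G {u} {v} uv = cong (λ b → if b then sgn G u v ◃ 1 else 0ℤ) uv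

adj≢0⇒edge : ∀ {n} (G : SignedGraph n) {u v} → adj G u v ≢ 0ℤ → edge G u v ≡ true
adj≢0⇒edge G {u} {v} adj≢0 with edge G u v
... | true  = refl
... | false = ⊥-elim (adj≢0 refl)

AlongEdges : ∀ {n} → SignedGraph n → (Fin n → Fin n) → Set
AlongEdges G s = ∀ x → x ≢ s x → edge G x (s x) ≡ true

IsEdgePerm : ∀ {n} → SignedGraph n → (Fin n → Fin n) → Set
IsEdgePerm G s = Injective _≡_ _≡_ s × AlongEdges G s

id-edgePerm : ∀ {n} (G : SignedGraph n) → IsEdgePerm G (λ x → x)
id-edgePerm G = (λ eq → eq) , (λ x x-moved → ⊥-elim (x-moved refl))

IsEdgePerm-cong : ∀ {n} {G : SignedGraph n} {s t} → (∀ i → t i ≡ s i) → IsEdgePerm G s → IsEdgePerm G t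
IsEdgePerm-cong {G = G} t≗s (s-injective , along) =
  (λ {x} {y} tx≡ty → s-injective (trans (sym (t≗s x)) (trans tx≡ty (t≗s y)))) ,
  (λ x x-moved → subst (λ y → edge G x y ≡ true) (sym (t≗s x)) (along x (subst (x ≢_) (t≗s x) x-moved)))

edgeSign : ∀ {n} → SignedGraph n → (Fin n → Fin n) → Fin n → Sign
edgeSign G s x = if does (x ≟ s x) then Sign.+ else sgn G x (s x)

edgeSign-moved : ∀ {n} (G : SignedGraph n) s {x} → x ≢ s x → edgeSign G s x ≡ sgn G x (s x)
edgeSign-moved G s {x} x-moved with x ≟ s x
... | yes x-fixed = ⊥-elim (x-moved x-fixed)
... | no  _       = refl

edgeSign-fixed : ∀ {n} (G : SignedGraph n) s {x} → x ≡ s x → edgeSign G s x ≡ Sign.+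
edgeSign-fixed G s {x} x-fixed with x ≟ s x
... | yes _       = refl
... | no  x-moved = ⊥-elim (x-moved x-fixed)

module _ {n} (G : SignedGraph n) {s : Fin n → Fin n} {k} (O : Orbit s k) where
  open Orbit O

  droppedSign : Fin n → Sign
  droppedSign x with x ≟ withoutOrbit O x
  ... | yes _ = edgeSign G s x
  ... | no  _ = Sign.+

  edgeSign-split : ∀ x → edgeSign G s x ≡ edgeSign G (withoutOrbit O) x Sign.* droppedSign x
  edgeSign-split x with x ≟ withoutOrbit O x
  ... | yes _      = sym (Sign.*-identityˡ _)
  ... | no x-moved = begin
    edgeSign G s x                            ≡⟨ edgeSign-moved G s (subst (x ≢_) x↦sx x-moved) ⟩
    sgn G x (s x)                             ≡⟨ cong (sgn G x) (sym x↦sx) ⟩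
    sgn G x (withoutOrbit O x)                ≡⟨ sym (Sign.*-identityʳ _) ⟩
    sgn G x (withoutOrbit O x) Sign.* Sign.+  ∎
    where
    open ≡-Reasoning
    x↦sx : withoutOrbit O x ≡ s x
    x↦sx = proj₂ (withoutOrbit-moved O x-moved)

  droppedSign-outside : ∀ {x} → ¬ InOrbit O x → droppedSign x ≡ Sign.+
  droppedSign-outside {x} x∉O with x ≟ withoutOrbit O x | withoutOrbit-cases O x
  ... | yes _       | inj₁ (x∈O , _)  = ⊥-elim (x∉O x∈O)
  ... | yes x-fixed | inj₂ (_ , x↦sx) = edgeSign-fixed G s (trans x-fixed x↦sx)
  ... | no  _       | _               = refl

  droppedSign-point : ∀ j → droppedSign (point j) ≡ edgeSign G s (point j)
  droppedSign-point j with point j ≟ withoutOrbit O (point j)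
  ... | yes _      = refl
  ... | no x-moved = ⊥-elim (proj₁ (withoutOrbit-moved O x-moved) (j , refl))

  ∏ˢ-droppedSign : ∏ˢ droppedSign ≡ ∏ˢ (edgeSign G s ∘ point)
  ∏ˢ-droppedSign = trans
    (sum-image Sign.*-commutativeMonoid point point-injective droppedSign
      (λ x x∉O → droppedSign-outside λ (j , point-j≡x) → x∉O j point-j≡x))
    (∏ˢ-cong droppedSign-point)

  withoutOrbit-along : AlongEdges G s → AlongEdges G (withoutOrbit O)
  withoutOrbit-along along x x-moved with withoutOrbit-moved O x-moved
  ... | _ , x↦sx = subst (λ y → edge G x y ≡ true) (sym x↦sx) (along x (subst (x ≢_) x↦sx x-moved))

module _ {n} {G : SignedGraph n} where

  module OrbitEdges {s k} (along : AlongEdges G s) (O : Orbit s (suc k)) where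
    open Orbit O

    point-moved : ∀ j → point j ≢ s (point j)
    point-moved j eq = next≢id j (point-injective (trans (sym (p-point j)) (sym eq)))

    point-adjacent : ∀ j → edge G (point j) (point (next j)) ≡ true
    point-adjacent j = subst (λ y → edge G (point j) y ≡ true) (p-point j) (along _ (point-moved j))

    edgeSign-point : ∀ j → edgeSign G s (point j) ≡ sgn G (point j) (point (next j))
    edgeSign-point j = trans (edgeSign-moved G s (point-moved j)) (cong (sgn G (point j)) (p-point j))

  orbit-edgeSign≡+ : Balanced G → ∀ {s k} → AlongEdges G s → (O : Orbit s k) →
                     Orbit.point O zero ≢ s (Orbit.point O zero) → ∏ˢ (edgeSign G s ∘ Orbit.point O) ≡ Sign.+
  orbit-edgeSign≡+ _ {k = zero} _ O start-moved = ⊥-elim (start-moved (sym (Orbit.p-point O zero)))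
  orbit-edgeSign≡+ _ {s} {suc zero} along O _ = begin
    ∏ˢ (edgeSign G s ∘ point)                            ≡⟨ ∏ˢ-cong edgeSign-point ⟩
    σ Sign.* (sgn G (point 1F) (point 0F) Sign.* Sign.+)
      ≡⟨ cong (λ τ → σ Sign.* (τ Sign.* Sign.+)) (sym (sgn-sym G _ _ (point-adjacent 0F))) ⟩
    σ Sign.* (σ Sign.* Sign.+)                           ≡⟨ cong (σ Sign.*_) (Sign.*-identityʳ σ) ⟩
    σ Sign.* σ                                           ≡⟨ Sign.s*s≡+ σ ⟩
    Sign.+                                               ∎
    where
    open ≡-Reasoning
    open Orbit O
    open OrbitEdges along O
    σ : Sign
    σ = sgn G (point 0F) (point 1F)
  orbit-edgeSign≡+ balanced {s} {suc (suc k)} along O _ = begin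
    ∏ˢ (edgeSign G s ∘ point)                    ≡⟨ ∏ˢ-cong edgeSign-point ⟩
    ∏ˢ (λ j → sgn G (point j) (point (next j)))  ≡⟨ sym (signProd≡∏ˢ (λ j → sgn G (point j) (point (next j)))) ⟩
    cycleSign C                                  ≡⟨ balanced k C ⟩
    Sign.+                                       ∎
    where
    open ≡-Reasoning
    open Orbit O
    open OrbitEdges along O
    C : Cycle G k
    C = record { vtx = point ; vtx-inj = point-injective ; vtx-adj = point-adjacent }

  edgeSign≡+ : Balanced G → ∀ {s} → IsEdgePerm G s → ∏ˢ (edgeSign G s) ≡ Sign.+
  edgeSign≡+ balanced {s} = go (<-wellFounded (movedPoints s))
    where
    go : ∀ {s} → Acc _<_ (movedPoints s) → IsEdgePerm G s → ∏ˢ (edgeSign G s) ≡ Sign.+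
    go {s} (acc smaller) (s-injective , along) with any? (moved? s)
    ... | no none-moved = sum-ε Sign.*-commutativeMonoid λ x →
      edgeSign-fixed G s (decidable-stable (x ≟ s x) (none-moved ∘ (x ,_)))
    ... | yes (a , a-moved) with orbitThrough s-injective a
    ... | k , O , refl = begin
      ∏ˢ (edgeSign G s)
        ≡⟨ ∏ˢ-cong (edgeSign-split G O) ⟩
      ∏ˢ (λ x → edgeSign G (withoutOrbit O) x Sign.* droppedSign G O x)
        ≡⟨ ∏ˢ-distrib (edgeSign G (withoutOrbit O)) (droppedSign G O) ⟩
      ∏ˢ (edgeSign G (withoutOrbit O)) Sign.* ∏ˢ (droppedSign G O)
        ≡⟨ cong₂ Sign._*_ rest≡+ (∏ˢ-droppedSign G O) ⟩
      Sign.+ Sign.* ∏ˢ (edgeSign G s ∘ Orbit.point O)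
        ≡⟨ orbit-edgeSign≡+ balanced along O a-moved ⟩
      Sign.+ ∎
      where
      open ≡-Reasoning
      rest≡+ : ∏ˢ (edgeSign G (withoutOrbit O)) ≡ Sign.+
      rest≡+ = go (smaller (withoutOrbit-movesFewer O a-moved))
                  (withoutOrbit-injective O s-injective , withoutOrbit-along G O along)

module _ {n} {G : SignedGraph n} where

  offDiagonalTerm-edgePerm : Balanced G → ∀ {s} → IsEdgePerm G s → offDiagonalTerm (adj G) s ≡ 1ℤ
  offDiagonalTerm-edgePerm balanced {s} s-edgePerm@(_ , along) = begin
    offDiagonalTerm (adj G) s         ≡⟨ prodℤ-cong factor-sign ⟩
    prodℤ (λ i → edgeSign G s i ◃ 1)  ≡⟨ prodℤ-◃ (edgeSign G s) ⟩
    ∏ˢ (edgeSign G s) ◃ 1             ≡⟨ cong (_◃ 1) (edgeSign≡+ balanced s-edgePerm) ⟩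
    1ℤ                                ∎
    where
    open ≡-Reasoning
    factor-sign : ∀ i → (if does (i ≟ s i) then 1ℤ else adj G i (s i)) ≡ edgeSign G s i ◃ 1
    factor-sign i with i ≟ s i
    ... | yes _       = refl
    ... | no  i-moved = adj-edge G (along i i-moved)

  offDiagonalTerm≢0⇒along : ∀ {s} → offDiagonalTerm (adj G) s ≢ 0ℤ → AlongEdges G s
  offDiagonalTerm≢0⇒along {s} term≢0 x x-moved =
    adj≢0⇒edge G λ adj≡0 → term≢0 (prodℤ-zero _ {x} (factor≡0 adj≡0))
    where
    factor≡0 : adj G x (s x) ≡ 0ℤ → (if does (x ≟ s x) then 1ℤ else adj G x (s x)) ≡ 0ℤ
    factor≡0 adj≡0 with x ≟ s x
    ... | yes x-fixed = ⊥-elim (x-moved x-fixed)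
    ... | no  _       = adj≡0

  offDiagonalTerm∈01 : Balanced G → ∀ {s} → Injective _≡_ _≡_ s →
                       offDiagonalTerm (adj G) s ≡ 0ℤ ⊎ offDiagonalTerm (adj G) s ≡ 1ℤ
  offDiagonalTerm∈01 balanced {s} s-injective with offDiagonalTerm (adj G) s ℤ.≟ 0ℤ
  ... | yes term≡0 = inj₁ term≡0
  ... | no  term≢0 = inj₂ (offDiagonalTerm-edgePerm balanced (s-injective , offDiagonalTerm≢0⇒along term≢0))

  permanentTerm∈01 : Balanced G → ∀ {t} → Injective _≡_ _≡_ t →
                     prodℤ (λ a → adj G a (t a)) ≡ 0ℤ ⊎ prodℤ (λ a → adj G a (t a)) ≡ 1ℤ
  permanentTerm∈01 balanced {t} t-injective with any? (λ a → a ≟ t a)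
  ... | yes (a , a-fixed) = inj₁ (prodℤ-zero _ {a} (trans (cong (adj G a) (sym a-fixed)) (adj-diagonal G a)))
  ... | no  no-fixed      = subst (λ c → c ≡ 0ℤ ⊎ c ≡ 1ℤ)
    (sym (permanentTerm-derangement (adj G) λ a a-fixed → no-fixed (a , a-fixed)))
    (offDiagonalTerm∈01 balanced t-injective)

  edgeDerangement⇒per>0 : Balanced G → ∀ {t} → IsEdgePerm G t → (∀ a → a ≢ t a) → 0ℤ ℤ.< perℤ (adj G)
  edgeDerangement⇒per>0 balanced {t} t-edgePerm@(t-injective , _) derangement =
    sum-perms-pos term (∈01⇒nonneg ∘ permanentTerm∈01 balanced) t-injective positive
    where
    term : (Fin n → Fin n) → ℤ
    term u = prodℤ (λ a → adj G a (u a))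
    positive : ∀ {u} → (∀ a → u a ≡ t a) → 0ℤ ℤ.< term u
    positive {u} u≗t = subst (0ℤ ℤ.<_) (sym (begin
      term u                     ≡⟨ prodℤ-cong (λ a → cong (adj G a) (u≗t a)) ⟩
      term t                     ≡⟨ permanentTerm-derangement (adj G) derangement ⟩
      offDiagonalTerm (adj G) t  ≡⟨ offDiagonalTerm-edgePerm balanced t-edgePerm ⟩
      1ℤ                         ∎)) (ℤ.+<+ (s≤s z≤n))
      where open ≡-Reasoning

movedPart : ∀ {n} {G : SignedGraph n} {s} → IsEdgePerm G s →
            ∃[ t ] IsEdgePerm (restrict G (enumerate (moved? s))) t × (∀ a → a ≢ t a)
movedPart {G = G} {s} (s-injective , along) = t , (t-injective , t-along) , t-derangement
  where
  I : Fin (movedPoints s) → Fin _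
  I = enumerate (moved? s)
  I-moved : ∀ a → I a ≢ s (I a)
  I-moved = enumerate-∈ (moved? s)
  t : Fin (movedPoints s) → Fin (movedPoints s)
  t a = proj₁ (enumerate-surjective (moved? s) (I-moved a ∘ s-injective))
  I∘t : ∀ a → I (t a) ≡ s (I a)
  I∘t a = proj₂ (enumerate-surjective (moved? s) (I-moved a ∘ s-injective))
  t-injective : Injective _≡_ _≡_ t
  t-injective {a} {b} ta≡tb =
    enumerate-injective (moved? s) (s-injective (trans (sym (I∘t a)) (trans (cong I ta≡tb) (I∘t b))))
  t-derangement : ∀ a → a ≢ t a
  t-derangement a a≡ta = I-moved a (trans (cong I a≡ta) (I∘t a))
  t-along : AlongEdges (restrict G I) t
  t-along a _ = subst (λ y → edge G (I a) y ≡ true) (sym (I∘t a)) (along (I a) (I-moved a))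

-- The nullity and the rank

module _ {n} {G : SignedGraph n} (balanced : Balanced G) where

  private
    fixedTerm : ℕ → (Fin n → Fin n) → ℤ
    fixedTerm k s = if fixedPoints s ℕ.≡ᵇ k then offDiagonalTerm (adj G) s else 0ℤ

  coeff≢0⇒edgePerm : ∀ {k} → coeff (perPoly (adj G)) k ≢ 0ℤ → ∃[ s ] IsEdgePerm G s × fixedPoints s ≡ k
  coeff≢0⇒edgePerm {k} coeff≢0 with sum-perms≢0⇒ (fixedTerm k) sum≢0
    where
    sum≢0 : sumℤ (fixedTerm k) (perms n) ≢ 0ℤ
    sum≢0 sum≡0 = coeff≢0 (trans (coeff-perPoly (adj G) (adj-diagonal G) k)
                                 (trans (cong (-1ℤ ℤ.^ k ℤ.*_) sum≡0) (ℤ.*-zeroʳ (-1ℤ ℤ.^ k))))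
  ... | s , s-injective , term≢0 with if-≢0 (fixedPoints s ℕ.≡ᵇ k) term≢0
  ... | fixed≡ᵇk , offDiagonal≢0 =
    s , (s-injective , offDiagonalTerm≢0⇒along {G = G} offDiagonal≢0) , ℕ.≡ᵇ⇒≡ _ k fixed≡ᵇk

  edgePerm⇒coeff≢0 : ∀ {s} → IsEdgePerm G s → coeff (perPoly (adj G)) (fixedPoints s) ≢ 0ℤ
  edgePerm⇒coeff≢0 {s} s-edgePerm@(s-injective , _) coeff≡0
    with ℤ.i*j≡0⇒i≡0∨j≡0 (-1ℤ ℤ.^ fixedPoints s)
           (trans (sym (coeff-perPoly (adj G) (adj-diagonal G) (fixedPoints s))) coeff≡0)
  ... | inj₁ sign≡0 with ℤ.i^n≡0⇒i≡0 -1ℤ (fixedPoints s) sign≡0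
  ...   | ()
  edgePerm⇒coeff≢0 {s} s-edgePerm@(s-injective , _) coeff≡0 | inj₂ sum≡0 =
    ℤ.<⇒≢ (sum-perms-pos (fixedTerm k) nonnegative s-injective positive) (sym sum≡0)
    where
    k : ℕ
    k = fixedPoints s
    nonnegative : ∀ {t} → Injective _≡_ _≡_ t → 0ℤ ℤ.≤ fixedTerm k t
    nonnegative {t} t-injective with fixedPoints t ℕ.≡ᵇ k
    ... | false = ℤ.≤-refl
    ... | true  = ∈01⇒nonneg (offDiagonalTerm∈01 balanced t-injective)
    positive : ∀ {t} → (∀ i → t i ≡ s i) → 0ℤ ℤ.< fixedTerm k t
    positive {t} t≗s with fixedPoints t ℕ.≡ᵇ k in fixed≡ᵇk
    ... | false = ⊥-elim (subst T fixed≡ᵇk (ℕ.≡⇒≡ᵇ (fixedPoints t) k (fixedPoints-cong t≗s)))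
    ... | true  = subst (0ℤ ℤ.<_) (sym (offDiagonalTerm-edgePerm balanced (IsEdgePerm-cong {G = G} t≗s s-edgePerm)))
                        (ℤ.+<+ (s≤s z≤n))

  edgePerm⇒minor : ∀ {s} → IsEdgePerm G s → HasNonzeroPerMinor (adj G) (movedPoints s)
  edgePerm⇒minor {s} s-edgePerm with movedPart {G = G} s-edgePerm
  ... | t , t-edgePerm , derangement = I , I , I-injective , I-injective , λ per≡0 →
    ℤ.<⇒≢ (edgeDerangement⇒per>0 (balanced-restrict I-injective balanced) t-edgePerm derangement) (sym per≡0)
    where
    I : Fin (movedPoints s) → Fin n
    I = enumerate (moved? s)
    I-injective : Injective _≡_ _≡_ I
    I-injective = enumerate-injective (moved? s)

-- A partial edge permutation f is read as the set of arcs x → f x with x ≢ f x; a fixed point of f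
-- carries no arc.
InjectiveOnMoved : ∀ {n} → (Fin n → Fin n) → Set
InjectiveOnMoved f = ∀ {x y} → x ≢ f x → y ≢ f y → f x ≡ f y → x ≡ y

IsPartialEdgePerm : ∀ {n} → SignedGraph n → (Fin n → Fin n) → Set
IsPartialEdgePerm G f = InjectiveOnMoved f × AlongEdges G f

Unreciprocated : ∀ {n} → (Fin n → Fin n) → Fin n → Set
Unreciprocated f x = x ≢ f x × f (f x) ≢ x

unreciprocated? : ∀ {n} (f : Fin n → Fin n) → Decidable (Unreciprocated f)
unreciprocated? f x = moved? f x ×-dec ¬? (f (f x) ≟ x)

unreciprocated : ∀ {n} → (Fin n → Fin n) → ℕ
unreciprocated f = count (unreciprocated? f)

fixed-image : ∀ {n} (f : Fin n → Fin n) {x y} → f x ≡ f y → y ≡ f y → f x ≡ f (f x)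
fixed-image f {x} {y} fx≡fy y-fixed = trans fx≡y (trans y-fixed (cong f (sym fx≡y)))
  where
  fx≡y : f x ≡ y
  fx≡y = trans fx≡fy (sym y-fixed)

closed⇒injective : ∀ {n} {f : Fin n → Fin n} → InjectiveOnMoved f → (∀ x → x ≢ f x → f x ≢ f (f x)) →
                   Injective _≡_ _≡_ f
closed⇒injective {f = f} f-injective closed {x} {y} fx≡fy with x ≟ f x | y ≟ f y
... | yes x-fixed | yes y-fixed = trans x-fixed (trans fx≡fy (sym y-fixed))
... | no  x-moved | no  y-moved = f-injective x-moved y-moved fx≡fy
... | no  x-moved | yes y-fixed = ⊥-elim (closed x x-moved (fixed-image f fx≡fy y-fixed))
... | yes x-fixed | no  y-moved = ⊥-elim (closed y y-moved (fixed-image f (sym fx≡fy) x-fixed))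

-- The arc u → w ends at w = f u, which carries no arc.  Adding the arc w → u and deleting the arc
-- into u (if any) keeps the number of moved points and makes u and w reciprocate each other, so
-- fewer arcs are unreciprocated.
module CloseEnd {n} {G : SignedGraph n} {f : Fin n → Fin n} (partial : IsPartialEdgePerm G f)
                {u} (u-moved : u ≢ f u) (end-fixed : f u ≡ f (f u)) where

  private
    w : Fin n
    w = f u
    f-injective : InjectiveOnMoved f
    f-injective = proj₁ partial
    along : AlongEdges G f
    along = proj₂ partial

  f′ : Fin n → Fin n
  f′ x with x ≟ w | f x ≟ u
  ... | yes _ | _     = u
  ... | no  _ | yes _ = x
  ... | no  _ | no  _ = f x

  data View (x f′x : Fin n) : Set where
    at-end    : x ≡ w → f′x ≡ u → View x f′x
    at-pred   : x ≢ w → f x ≡ u → f′x ≡ x → View x f′x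
    elsewhere : x ≢ w → f x ≢ u → f′x ≡ f x → View x f′x

  view : ∀ x → View x (f′ x)
  view x with x ≟ w | f x ≟ u
  ... | yes x≡w | _        = at-end x≡w refl
  ... | no  x≢w | yes fx≡u = at-pred x≢w fx≡u refl
  ... | no  x≢w | no  fx≢u = elsewhere x≢w fx≢u refl

  f′-w : f′ w ≡ u
  f′-w with view w
  ... | at-end _ w↦u      = w↦u
  ... | at-pred w≢w _ _   = ⊥-elim (w≢w refl)
  ... | elsewhere w≢w _ _ = ⊥-elim (w≢w refl)

  f′-u : f′ u ≡ w
  f′-u with view u
  ... | at-end u≡w _       = ⊥-elim (u-moved u≡w)
  ... | at-pred _ fu≡u _   = ⊥-elim (u-moved (sym fu≡u))
  ... | elsewhere _ _ u↦w = u↦w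

  f′-injective : InjectiveOnMoved f′
  f′-injective {x} {y} x-moved y-moved f′x≡f′y with view x | view y
  ... | at-end x≡w _        | at-end y≡w _        = trans x≡w (sym y≡w)
  ... | at-pred _ _ x-fixed | _                   = ⊥-elim (x-moved (sym x-fixed))
  ... | _                   | at-pred _ _ y-fixed = ⊥-elim (y-moved (sym y-fixed))
  ... | at-end _ x↦u | elsewhere _ fy≢u y↦fy = ⊥-elim (fy≢u (trans (sym y↦fy) (trans (sym f′x≡f′y) x↦u)))
  ... | elsewhere _ fx≢u x↦fx | at-end _ y↦u = ⊥-elim (fx≢u (trans (sym x↦fx) (trans f′x≡f′y y↦u)))
  ... | elsewhere _ _ x↦fx | elsewhere _ _ y↦fy =
    f-injective (subst (x ≢_) x↦fx x-moved) (subst (y ≢_) y↦fy y-moved) (trans (sym x↦fx) (trans f′x≡f′y y↦fy))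

  f′-along : AlongEdges G f′
  f′-along x x-moved with view x
  ... | at-end x≡w x↦u      = subst₂ (λ a b → edge G a b ≡ true) (sym x≡w) (sym x↦u)
                                     (trans (edge-sym G w u) (along u u-moved))
  ... | at-pred _ _ x-fixed = ⊥-elim (x-moved (sym x-fixed))
  ... | elsewhere _ _ x↦fx  = subst (λ y → edge G x y ≡ true) (sym x↦fx) (along x (subst (x ≢_) x↦fx x-moved))

  f′-partial : IsPartialEdgePerm G f′
  f′-partial = f′-injective , f′-along

  Unreciprocated-f′⇒f : ∀ {x} → Unreciprocated f′ x → Unreciprocated f x
  Unreciprocated-f′⇒f {x} (x-moved′ , f′f′x≢x) with view x
  ... | at-end x≡w x↦u      = ⊥-elim (f′f′x≢x (trans (cong f′ x↦u) (trans f′-u (sym x≡w))))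
  ... | at-pred _ _ x-fixed = ⊥-elim (x-moved′ (sym x-fixed))
  ... | elsewhere _ _ x↦fx with subst (x ≢_) x↦fx x-moved′ | view (f x)
  ...   | x-moved | at-end fx≡w _ =
    ⊥-elim (f′f′x≢x (trans (cong f′ x↦fx) (trans (cong f′ fx≡w) (trans f′-w (sym x≡u)))))
    where
    x≡u : x ≡ u
    x≡u = f-injective x-moved u-moved fx≡w
  ...   | x-moved | at-pred fx≢w ffx≡u _ = x-moved , λ ffx≡x → fx≢w (cong f (trans (sym ffx≡x) ffx≡u))
  ...   | x-moved | elsewhere _ _ fx↦ffx = x-moved , λ ffx≡x → f′f′x≢x (trans (cong f′ x↦fx) (trans fx↦ffx ffx≡x))

  unreciprocated-f′<f : unreciprocated f′ < unreciprocated f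
  unreciprocated-f′<f = count-< (unreciprocated? f′) (unreciprocated? f)
    Unreciprocated-f′⇒f
    (u-moved , λ ffu≡u → u-moved (sym (trans end-fixed ffu≡u)))
    (λ (_ , f′f′u≢u) → f′f′u≢u (trans (cong f′ f′-u) f′-w))

  -- The point whose arc into u is deleted is traded for w.
  redirect : Fin n → Fin n
  redirect x with f x ≟ u
  ... | yes _ = w
  ... | no  _ = x

  movedPoints-f≤f′ : movedPoints f ≤ movedPoints f′
  movedPoints-f≤f′ = injectiveOn⇒count≤ (moved? f) (moved? f′) redirect redirect-injective redirect-moved
    where
    w-fixed : ∀ {y} → w ≡ y → y ≡ f y
    w-fixed w≡y = trans (sym w≡y) (trans end-fixed (cong f w≡y))
    redirect-injective : ∀ {x y} → x ≢ f x → y ≢ f y → redirect x ≡ redirect y → x ≡ y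
    redirect-injective {x} {y} x-moved y-moved eq with f x ≟ u | f y ≟ u
    ... | yes fx≡u | yes fy≡u = f-injective x-moved y-moved (trans fx≡u (sym fy≡u))
    ... | yes _    | no  _    = ⊥-elim (y-moved (w-fixed eq))
    ... | no  _    | yes _    = ⊥-elim (x-moved (w-fixed (sym eq)))
    ... | no  _    | no  _    = eq
    redirect-moved : ∀ {x} → x ≢ f x → redirect x ≢ f′ (redirect x)
    redirect-moved {x} x-moved with f x ≟ u
    ... | yes _ = λ w≡f′w → u-moved (sym (trans w≡f′w f′-w))
    ... | no fx≢u with view x
    ...   | at-end x≡w _       = ⊥-elim (x-moved (w-fixed (sym x≡w)))
    ...   | at-pred _ fx≡u _   = ⊥-elim (fx≢u fx≡u)
    ...   | elsewhere _ _ x↦fx = subst (x ≢_) (sym x↦fx) x-moved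

module _ {n} {G : SignedGraph n} where

  partial⇒edgePerm : ∀ {f} → IsPartialEdgePerm G f → ∃[ s ] IsEdgePerm G s × movedPoints f ≤ movedPoints s
  partial⇒edgePerm {f} = go (<-wellFounded (unreciprocated f))
    where
    go : ∀ {f} → Acc _<_ (unreciprocated f) → IsPartialEdgePerm G f →
         ∃[ s ] IsEdgePerm G s × movedPoints f ≤ movedPoints s
    go {f} (acc smaller) partial@(f-injective , along) with any? (λ u → moved? f u ×-dec (f u ≟ f (f u)))
    ... | no  no-end = f , (closed⇒injective f-injective closed , along) , ℕ.≤-refl
      where
      closed : ∀ x → x ≢ f x → f x ≢ f (f x)
      closed x x-moved end-fixed = no-end (x , x-moved , end-fixed)
    ... | yes (u , u-moved , end-fixed) =
      map₂ (map₂ (ℕ.≤-trans movedPoints-f≤f′)) (go (smaller unreciprocated-f′<f) f′-partial)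
      where open CloseEnd {G = G} partial u-moved end-fixed

  matching⇒partialEdgePerm : ∀ {k} (I J : Fin k → Fin n) → Injective _≡_ _≡_ I → Injective _≡_ _≡_ J →
    (∀ a → edge G (I a) (J a) ≡ true) → ∃[ f ] IsPartialEdgePerm G f × k ≤ movedPoints f
  matching⇒partialEdgePerm {k} I J I-injective J-injective matched = f , (f-injective , f-along) , k≤moved
    where
    f : Fin n → Fin n
    f x with any? (λ a → I a ≟ x)
    ... | yes (a , _) = J a
    ... | no  _       = x
    cases : ∀ x → (∃[ a ] I a ≡ x × f x ≡ J a) ⊎ ((∀ a → I a ≢ x) × f x ≡ x)
    cases x with any? (λ a → I a ≟ x)
    ... | yes (a , Ia≡x) = inj₁ (a , Ia≡x , refl)
    ... | no  unmatched  = inj₂ ((λ a Ia≡x → unmatched (a , Ia≡x)) , refl)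
    matched-point : ∀ {x} → x ≢ f x → ∃[ a ] I a ≡ x × f x ≡ J a
    matched-point {x} x-moved with cases x
    ... | inj₁ found     = found
    ... | inj₂ (_ , x↦x) = ⊥-elim (x-moved (sym x↦x))
    f-injective : InjectiveOnMoved f
    f-injective x-moved y-moved fx≡fy with matched-point x-moved | matched-point y-moved
    ... | a , refl , x↦Ja | b , refl , y↦Jb = cong I (J-injective (trans (sym x↦Ja) (trans fx≡fy y↦Jb)))
    f-along : AlongEdges G f
    f-along x x-moved with matched-point x-moved
    ... | a , refl , x↦Ja = subst (λ y → edge G (I a) y ≡ true) (sym x↦Ja) (matched a)
    I-moved : ∀ a → I a ≢ f (I a)
    I-moved a with cases (I a)
    ... | inj₁ (b , Ib≡Ia , Ia↦Jb) = subst (I a ≢_) (sym Ia↦Jb) (subst (_≢ J b) Ib≡Ia (edge⇒≢ G (matched b)))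
    ... | inj₂ (unmatched , _)     = ⊥-elim (unmatched a refl)
    k≤moved : k ≤ movedPoints f
    k≤moved = subst (_≤ movedPoints f) (count-all (λ _ → yes tt) (λ _ → tt))
      (injectiveOn⇒count≤ (λ _ → yes tt) (moved? f) I (λ _ _ → I-injective) (λ {a} _ → I-moved a))

  minor⇒edgePerm : ∀ {k} → HasNonzeroPerMinor (adj G) k → ∃[ s ] IsEdgePerm G s × k ≤ movedPoints s
  minor⇒edgePerm {k} (I , J , I-injective , J-injective , per≢0)
    with sum-perms≢0⇒ (λ t → prodℤ (λ a → adj G (I a) (J (t a)))) per≢0
  ... | t , t-injective , term≢0 with matching⇒partialEdgePerm I (J ∘ t) I-injective (t-injective ∘ J-injective) matched
    where
    matched : ∀ a → edge G (I a) (J (t a)) ≡ true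
    matched a = adj≢0⇒edge G λ entry≡0 → term≢0 (prodℤ-zero _ {a} entry≡0)
  ... | f , f-partial , k≤moved = map₂ (map₂ (ℕ.≤-trans k≤moved)) (partial⇒edgePerm f-partial)

theorem4 : (n : ℕ) (G : SignedGraph n) → Balanced G →
    ∃[ r ] ∃[ e ] (IsPerRank (adj G) r × IsPerNullity (adj G) e × r + e ≡ n)
theorem4 n G balanced with least (λ k → ¬? (coeff (perPoly (adj G)) k ℤ.≟ 0ℤ)) coeff-n≢0
  where
  coeff-n≢0 : coeff (perPoly (adj G)) n ≢ 0ℤ
  coeff-n≢0 = subst (λ k → coeff (perPoly (adj G)) k ≢ 0ℤ) (count-all (λ i → i ≟ i) (λ _ → refl))
                    (edgePerm⇒coeff≢0 balanced (id-edgePerm G))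
... | e , coeff-e≢0 , below-e = n ∸ e , e , (attained , bounded) , (vanishing , coeff-e≢0) , ℕ.m∸n+n≡m e≤n
  where
  e≤fixedPoints : ∀ {s} → IsEdgePerm G s → e ≤ fixedPoints s
  e≤fixedPoints s-edgePerm = ℕ.≮⇒≥ λ fixed<e → below-e fixed<e (edgePerm⇒coeff≢0 balanced s-edgePerm)
  e≤n : e ≤ n
  e≤n = subst (e ≤_) (count-all (λ i → i ≟ i) (λ _ → refl)) (e≤fixedPoints (id-edgePerm G))
  vanishing : ∀ k → k < e → coeff (perPoly (adj G)) k ≡ 0ℤ
  vanishing k k<e = decidable-stable (coeff (perPoly (adj G)) k ℤ.≟ 0ℤ) (below-e k<e)
  attained : HasNonzeroPerMinor (adj G) (n ∸ e)
  attained with coeff≢0⇒edgePerm balanced coeff-e≢0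
  ... | s , s-edgePerm , refl =
    subst (HasNonzeroPerMinor (adj G)) (movedPoints≡n∸fixedPoints s) (edgePerm⇒minor balanced s-edgePerm)
  bounded : ∀ k → HasNonzeroPerMinor (adj G) k → k ≤ n ∸ e
  bounded k minor with minor⇒edgePerm {G = G} minor
  ... | s , s-edgePerm , k≤moved = ℕ.≤-trans k≤moved
    (subst (_≤ n ∸ e) (sym (movedPoints≡n∸fixedPoints s)) (ℕ.∸-monoʳ-≤ n (e≤fixedPoints s-edgePerm)))
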